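{- Let $a,b,k$ be integers with $k\ge b>a\ge1$. For $m\ge 2$ and $0\le h\le m-1$ let $\mathcal{BD}_{a,b,k}(m,h,a)$ (resp. $\mathcal{BD}_{a,b,k}(m,h,b)$) be the set of partitions $\lambda=(\lambda_1,\dots,\lambda_m)$ in $\mathcal{BD}_{a,b,k}(m)$ with largest part $kh+k(m-1)+a$ (resp. $kh+k(m-1)+b$), where $\mathcal{BD}_{a,b,k}(m)$ is the set of partitions with exactly $m$ parts, all congruent to $a$ or $b$ modulo $k$, such that $\lambda_m\in\{a,b\}$ and for $1\le i<m$: $\lambda_i-\lambda_{i+1}\ge k$ with strict inequality if $\lambda_i\equiv b\pmod k$, and $\lambda_i-\lambda_{i+1}\le 2k$ with strict inequality if $\lambda_{i+1}\equiv a\pmod k$. Then for $m\ge2$ and $1\le h\le m-1$, \[\sum_{\lambda\in\mathcal{BD}_{a,b,k}(m+1,h,a)}u^{\ell_a(\lambda)}v^{\ell_b(\lambda)}q^{|\lambda|}=uq^{kh+km+a}\Big(\sum_{\lambda\in\mathcal{BD}_{a,b,k}(m,h,a)}u^{\ell_a(\lambda)}v^{\ell_b(\lambda)}q^{|\lambda|}+\sum_{\lambda\in\mathcal{BD}_{a,b,k}(m,h-1,b)}u^{\ell_a(\lambda)}v^{\ell_b(\lambda)}q^{|\lambda|}\Big).\]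
   Context: A partition is a finite non-increasing sequence of positive integers; $|\lambda|$ is the sum of its parts; $\ell_a(\lambda)$, $\ell_b(\lambda)$ are the numbers of parts congruent to $a$, resp. $b$, modulo $k$. -}

module Defs where

open import Level using (Level)
open import Data.Nat using (ℕ; zero; suc; _+_; _*_; _∸_; _≤_; _<_; NonZero; _≟_; _≤?_; _<?_)
open import Data.Nat.DivMod using (_%_)
open import Data.List using (List; []; _∷_; length; filter; map; concatMap; upTo; last; head; foldr)
open import Data.Nat.ListAction using (sum)
open import Data.List.Relation.Unary.All using (All; all?)
open import Data.Maybe using (Maybe; just; nothing)
open import Data.Maybe.Properties using (≡-dec)
open import Data.Product using (_×_)
open import Data.Sum using (_⊎_)
open import Relation.Nullary using (Dec)
open import Relation.Nullary.Decidable using (_×-dec_; _⊎-dec_; _→-dec_)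
open import Relation.Binary.PropositionalEquality using (_≡_)
open import Algebra.Bundles using (CommutativeSemiring)
import Algebra.Definitions.RawSemiring as RS

-- A partition with m parts is represented by the list (λ₁ , … , λₘ) of its parts.

NonIncr : List ℕ → Set
NonIncr []            = _≡_ 0 0
NonIncr (x ∷ [])      = _≡_ 0 0
NonIncr (x ∷ y ∷ ys)  = (y ≤ x) × NonIncr (y ∷ ys)

IsPartition : List ℕ → Set
IsPartition λs = All (λ x → 0 < x) λs × NonIncr λs

module _ (a b k : ℕ) .{{_ : NonZero k}} where

  CongMod : ℕ → ℕ → Set
  CongMod x r = x % k ≡ r % k

  GapCond : ℕ → ℕ → Set
  GapCond x y = (y + k ≤ x) × (CongMod x b → y + k < x)
              × (x ≤ y + 2 * k) × (CongMod y a → x < y + 2 * k)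

  Gaps : List ℕ → Set
  Gaps []           = _≡_ 0 0
  Gaps (x ∷ [])     = _≡_ 0 0
  Gaps (x ∷ y ∷ ys) = GapCond x y × Gaps (y ∷ ys)

  BD : ℕ → List ℕ → Set
  BD m λs = IsPartition λs × (length λs ≡ m)
          × All (λ x → CongMod x a ⊎ CongMod x b) λs
          × ((last λs ≡ just a) ⊎ (last λs ≡ just b))
          × Gaps λs

  maxPart : ℕ → ℕ → ℕ → ℕ
  maxPart m h c = k * h + k * (m ∸ 1) + c

  BDmhc : ℕ → ℕ → ℕ → List ℕ → Set
  BDmhc m h c λs = BD m λs × (head λs ≡ just (maxPart m h c))

  congMod? : ∀ x r → Dec (CongMod x r)
  congMod? x r = x % k ≟ r % k

  nonIncr? : ∀ xs → Dec (NonIncr xs)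
  nonIncr? []           = 0 ≟ 0
  nonIncr? (x ∷ [])     = 0 ≟ 0
  nonIncr? (x ∷ y ∷ ys) = (y ≤? x) ×-dec nonIncr? (y ∷ ys)

  gaps? : ∀ xs → Dec (Gaps xs)
  gaps? []           = 0 ≟ 0
  gaps? (x ∷ [])     = 0 ≟ 0
  gaps? (x ∷ y ∷ ys) =
    ((y + k ≤? x) ×-dec (congMod? x b →-dec (y + k <? x))
      ×-dec (x ≤? y + 2 * k) ×-dec (congMod? y a →-dec (x <? y + 2 * k)))
    ×-dec gaps? (y ∷ ys)

  BDmhc? : ∀ m h c xs → Dec (BDmhc m h c xs)
  BDmhc? m h c xs =
    (((all? (λ x → 0 <? x) xs ×-dec nonIncr? xs) ×-dec (length xs ≟ m)
      ×-dec all? (λ x → congMod? x a ⊎-dec congMod? x b) xs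
      ×-dec (≡-dec _≟_ (last xs) (just a) ⊎-dec ≡-dec _≟_ (last xs) (just b))
      ×-dec gaps? xs)
    ×-dec ≡-dec _≟_ (head xs) (just (maxPart m h c)))

  boxes : ℕ → ℕ → List (List ℕ)
  boxes zero    N = [] ∷ []
  boxes (suc m) N = concatMap (λ x → map (x ∷_) (boxes m N)) (upTo (suc N))

  ℓ : ℕ → List ℕ → ℕ
  ℓ r λs = length (filter (λ x → congMod? x r) λs)

  size : List ℕ → ℕ
  size = sum

  -- the finite set 𝓑𝓓_{a,b,k}(m,h,c), listed (every part is ≤ the largest part)
  BDlist : ℕ → ℕ → ℕ → List (List ℕ)
  BDlist m h c = filter (BDmhc? m h c) (boxes m (maxPart m h c))

  module _ {c ℓ' : Level} (R : CommutativeSemiring c ℓ') where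
    open CommutativeSemiring R renaming (_+_ to _⊕_; _*_ to _⊛_)
    open RS rawSemiring using (_^_)

    GF : Carrier → Carrier → Carrier → ℕ → ℕ → ℕ → Carrier
    GF u v q m h c' = foldr
      (λ λs acc → ((u ^ ℓ a λs) ⊛ (v ^ ℓ b λs)) ⊛ (q ^ size λs) ⊕ acc) 0#
      (BDlist m h c')

pow : ∀ {c ℓ' : Level} (R : CommutativeSemiring c ℓ') → CommutativeSemiring.Carrier R → ℕ → CommutativeSemiring.Carrier R
pow R = RS._^_ (CommutativeSemiring.rawSemiring R)

{-# OPTIONS --safe #-}
-- Write N = kh + km + a for the largest part of a partition in BD(m+1,h,a).
-- Since N ≡ a (mod k), the gap conditions between N and the next part y
-- admit exactly two values of y: the one with y ≡ a is N - k, the largest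
-- part of BD(m,h,a), and the one with y ≡ b is N - 2k + (b - a), the
-- largest part of BD(m,h-1,b); the remaining conditions only concern the
-- tail. So removing the largest part is a bijection from BD(m+1,h,a) onto
-- the disjoint union BD(m,h,a) ⊎ BD(m,h-1,b), and it divides the weight
-- u^ℓa v^ℓb q^|λ| by u q^N.
module Submission where

open import Defs
open import Level using (Level)
open import Data.Nat using (ℕ; zero; suc; _+_; _*_; _∸_; _≤_; _<_; NonZero; z≤n; s≤s; >-nonZero⁻¹)
import Data.Nat.Properties as ℕₚ
open import Data.Nat.DivMod using (_%_; _/_; m≡m%n+[m/n]*n; [m+n]%n≡m%n; [m+kn]%n≡m%n; %-distribˡ-+; %-remove-+ˡ)
open import Data.Nat.Divisibility using (m∣m*n; ∣m∣n⇒∣m+n)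
open import Data.Nat.Tactic.RingSolver using (solve-∀)
open import Data.List using (List; []; _∷_; map; concatMap; applyUpTo; upTo; filter; foldr; _++_; length)
open import Data.List.Properties using (filter-accept; filter-reject)
open import Data.List.Relation.Unary.All as All using (All; []; _∷_)
open import Data.Maybe using (just)
open import Data.Maybe.Properties using (just-injective)
open import Data.Product using (_×_; _,_; proj₁; proj₂)
open import Data.Sum using (_⊎_; inj₁; inj₂; [_,_])
open import Function using (_∘_; id; _⇔_; mk⇔; Equivalence)
open import Relation.Nullary using (¬_; Dec; yes; no; contradiction)
open import Relation.Unary using (Decidable)
open import Relation.Binary.PropositionalEquality
  using (_≡_; _≢_; refl; sym; trans; cong; cong₂; subst; subst₂; module ≡-Reasoning)
open import Relation.Binary.Definitions using (tri<; tri≈; tri>)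
open import Algebra.Bundles using (CommutativeSemiring)
import Algebra.Definitions.RawSemiring as RawSemiringDefinitions
import Algebra.Properties.Semiring.Exp as SemiringExp
import Algebra.Properties.CommutativeSemigroup as CommutativeSemigroupProperties

module _ (k : ℕ) .{{_ : NonZero k}} where

  +-%-cong : ∀ {x x′ y y′} → x % k ≡ x′ % k → y % k ≡ y′ % k → (x + y) % k ≡ (x′ + y′) % k
  +-%-cong {x} {x′} {y} {y′} x≡x′ y≡y′ = begin
    (x + y) % k           ≡⟨ %-distribˡ-+ x y k ⟩
    (x % k + y % k) % k   ≡⟨ cong₂ (λ r s → (r + s) % k) x≡x′ y≡y′ ⟩
    (x′ % k + y′ % k) % k ≡⟨ %-distribˡ-+ x′ y′ k ⟨
    (x′ + y′) % k         ∎
    where open ≡-Reasoning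

  %-≡∧/-<⇒+k≤ : ∀ {x y} → x % k ≡ y % k → x / k < y / k → x + k ≤ y
  %-≡∧/-<⇒+k≤ {x} {y} x≡y x/k<y/k = begin
    x + k                   ≡⟨ cong (_+ k) (m≡m%n+[m/n]*n x k) ⟩
    x % k + x / k * k + k   ≡⟨ trans (ℕₚ.+-assoc (x % k) _ k) (cong (x % k +_) (ℕₚ.+-comm _ k)) ⟩
    x % k + suc (x / k) * k ≤⟨ ℕₚ.+-mono-≤ (ℕₚ.≤-reflexive x≡y) (ℕₚ.*-monoˡ-≤ k x/k<y/k) ⟩
    y % k + y / k * k       ≡⟨ m≡m%n+[m/n]*n y k ⟨
    y                       ∎
    where open ℕₚ.≤-Reasoning

  %-window-unique : ∀ {x y} → x % k ≡ y % k → x < y + k → y < x + k → x ≡ y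
  %-window-unique {x} {y} x≡y x<y+k y<x+k with ℕₚ.<-cmp (x / k) (y / k)
  ... | tri< x/k<y/k _ _ = contradiction (%-≡∧/-<⇒+k≤ x≡y x/k<y/k) (ℕₚ.<⇒≱ y<x+k)
  ... | tri> _ _ y/k<x/k = contradiction (%-≡∧/-<⇒+k≤ (sym x≡y) y/k<x/k) (ℕₚ.<⇒≱ x<y+k)
  ... | tri≈ _ x/k≡y/k _ = begin
    x                 ≡⟨ m≡m%n+[m/n]*n x k ⟩
    x % k + x / k * k ≡⟨ cong₂ (λ r s → r + s * k) x≡y x/k≡y/k ⟩
    y % k + y / k * k ≡⟨ m≡m%n+[m/n]*n y k ⟨
    y                 ∎
    where open ≡-Reasoning

module ListSum {ℓ₁ ℓ₂ : Level} (R : CommutativeSemiring ℓ₁ ℓ₂) where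
  open CommutativeSemiring R
    renaming (_+_ to _⊕_; _*_ to _⊛_; refl to ≈-refl; sym to ≈-sym; trans to ≈-trans)
  open CommutativeSemigroupProperties +-commutativeSemigroup using (interchange)

  ∑ : {A : Set} → (A → Carrier) → List A → Carrier
  ∑ f = foldr (λ x acc → f x ⊕ acc) 0#

  ∑-cong : ∀ {A : Set} {f g : A → Carrier} → (∀ x → f x ≈ g x) → ∀ xs → ∑ f xs ≈ ∑ g xs
  ∑-cong f≈g []       = ≈-refl
  ∑-cong f≈g (x ∷ xs) = +-cong (f≈g x) (∑-cong f≈g xs)

  ∑-zero : ∀ {A : Set} {f : A → Carrier} → (∀ x → f x ≈ 0#) → ∀ xs → ∑ f xs ≈ 0#
  ∑-zero f≈0 []       = ≈-refl
  ∑-zero f≈0 (x ∷ xs) = ≈-trans (+-cong (f≈0 x) (∑-zero f≈0 xs)) (+-identityˡ 0#)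

  ∑-++ : ∀ {A : Set} (f : A → Carrier) xs ys → ∑ f (xs ++ ys) ≈ ∑ f xs ⊕ ∑ f ys
  ∑-++ f []       ys = ≈-sym (+-identityˡ _)
  ∑-++ f (x ∷ xs) ys = ≈-trans (+-congˡ (∑-++ f xs ys)) (≈-sym (+-assoc _ _ _))

  ∑-map : ∀ {A B : Set} (f : B → Carrier) (g : A → B) xs → ∑ f (map g xs) ≡ ∑ (f ∘ g) xs
  ∑-map f g []       = refl
  ∑-map f g (x ∷ xs) = cong (f (g x) ⊕_) (∑-map f g xs)

  ∑-concatMap : ∀ {A B : Set} (f : B → Carrier) (g : A → List B) xs →
                ∑ f (concatMap g xs) ≈ ∑ (∑ f ∘ g) xs
  ∑-concatMap f g []       = ≈-refl
  ∑-concatMap f g (x ∷ xs) =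
    ≈-trans (∑-++ f (g x) (concatMap g xs)) (+-congˡ (∑-concatMap f g xs))

  ∑-+ : ∀ {A : Set} (f g : A → Carrier) xs → ∑ (λ x → f x ⊕ g x) xs ≈ ∑ f xs ⊕ ∑ g xs
  ∑-+ f g []       = ≈-sym (+-identityˡ 0#)
  ∑-+ f g (x ∷ xs) = ≈-trans (+-congˡ (∑-+ f g xs)) (interchange (f x) (g x) (∑ f xs) (∑ g xs))

  ∑-*ˡ : ∀ {A : Set} (z : Carrier) (f : A → Carrier) xs → ∑ (λ x → z ⊛ f x) xs ≈ z ⊛ ∑ f xs
  ∑-*ˡ z f []       = ≈-sym (zeroʳ z)
  ∑-*ˡ z f (x ∷ xs) = ≈-trans (+-congˡ (∑-*ˡ z f xs)) (≈-sym (distribˡ z (f x) (∑ f xs)))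

  ∑-applyUpTo-truncate : ∀ {B : Set} (g : B → Carrier) (f : ℕ → B) {n n′} → n ≤ n′ →
                         (∀ i → n ≤ i → g (f i) ≈ 0#) →
                         ∑ g (applyUpTo f n′) ≈ ∑ g (applyUpTo f n)
  ∑-applyUpTo-truncate g f {zero} {zero}    _ _ = ≈-refl
  ∑-applyUpTo-truncate g f {zero} {suc n′} _ vanish = ≈-trans
    (+-cong (vanish 0 z≤n) (∑-applyUpTo-truncate g (f ∘ suc) {0} {n′} z≤n (λ i _ → vanish (suc i) z≤n)))
    (+-identityˡ 0#)
  ∑-applyUpTo-truncate g f {suc n} {suc n′} (s≤s n≤n′) vanish =
    +-congˡ (∑-applyUpTo-truncate g (f ∘ suc) n≤n′ (λ i n≤i → vanish (suc i) (s≤s n≤i)))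

  ∑-applyUpTo-single : ∀ {B : Set} (g : B → Carrier) (f : ℕ → B) {n} j → j < n →
                       (∀ i → i ≢ j → g (f i) ≈ 0#) → ∑ g (applyUpTo f n) ≈ g (f j)
  ∑-applyUpTo-single g f {suc n} zero    _         vanish = ≈-trans
    (+-congˡ (∑-applyUpTo-truncate g (f ∘ suc) {0} {n} z≤n (λ i _ → vanish (suc i) λ ())))
    (+-identityʳ _)
  ∑-applyUpTo-single g f {suc n} (suc j) (s≤s j<n) vanish = ≈-trans
    (+-congʳ (vanish 0 λ ()))
    (≈-trans (+-identityˡ _)
      (∑-applyUpTo-single g (f ∘ suc) j j<n (λ i i≢j → vanish (suc i) (i≢j ∘ ℕₚ.suc-injective))))

  indicator : {A : Set} → Dec A → Carrier → Carrier
  indicator (yes _) x = x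
  indicator (no _)  _ = 0#

  module _ {A : Set} where

    indicator-no : (d : Dec A) {x : Carrier} → ¬ A → indicator d x ≈ 0#
    indicator-no (yes a) ¬a = contradiction a ¬a
    indicator-no (no _)  ¬a = ≈-refl

    indicator-cong : (d : Dec A) {x y : Carrier} → x ≈ y → indicator d x ≈ indicator d y
    indicator-cong (yes _) x≈y = x≈y
    indicator-cong (no _)  _   = ≈-refl

    indicator-*ˡ : (d : Dec A) (z x : Carrier) → indicator d (z ⊛ x) ≈ z ⊛ indicator d x
    indicator-*ˡ (yes _) z x = ≈-refl
    indicator-*ˡ (no _)  z x = ≈-sym (zeroʳ z)

    indicator-⊎ : ∀ {B D : Set} (dA : Dec A) (dB : Dec B) (dD : Dec D) {x : Carrier} →
                  A ⇔ (B ⊎ D) → ¬ (B × D) →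
                  indicator dA x ≈ indicator dB x ⊕ indicator dD x
    indicator-⊎ _       (yes b) (yes d) _     disjoint = contradiction (b , d) disjoint
    indicator-⊎ (yes _) (yes _) (no _)  _     _ = ≈-sym (+-identityʳ _)
    indicator-⊎ (yes _) (no _)  (yes _) _     _ = ≈-sym (+-identityˡ _)
    indicator-⊎ (yes a) (no ¬b) (no ¬d) A⇔B⊎D _ = contradiction (Equivalence.to A⇔B⊎D a) [ ¬b , ¬d ]
    indicator-⊎ (no ¬a) (yes b) _       A⇔B⊎D _ = contradiction (Equivalence.from A⇔B⊎D (inj₁ b)) ¬a
    indicator-⊎ (no ¬a) (no _)  (yes d) A⇔B⊎D _ = contradiction (Equivalence.from A⇔B⊎D (inj₂ d)) ¬a
    indicator-⊎ (no _)  (no _)  (no _)  _     _ = ≈-sym (+-identityˡ 0#)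

  restrict : {A : Set} {P : A → Set} → Decidable P → (A → Carrier) → A → Carrier
  restrict P? f x = indicator (P? x) (f x)

  ∑-filter : ∀ {A : Set} {P : A → Set} (P? : Decidable P) (f : A → Carrier) xs →
             ∑ f (filter P? xs) ≈ ∑ (restrict P? f) xs
  ∑-filter P? f []       = ≈-refl
  ∑-filter P? f (x ∷ xs) with P? x
  ... | yes _ = +-congˡ (∑-filter P? f xs)
  ... | no _  = ≈-trans (∑-filter P? f xs) (≈-sym (+-identityˡ _))

module BoxSum (a b k : ℕ) .{{_ : NonZero k}} {ℓ₁ ℓ₂ : Level} (R : CommutativeSemiring ℓ₁ ℓ₂) where
  open CommutativeSemiring R
    renaming (_+_ to _⊕_; _*_ to _⊛_; refl to ≈-refl; sym to ≈-sym; trans to ≈-trans)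
  open ListSum R
  open import Relation.Binary.Reasoning.Setoid setoid

  ∑-boxes-suc : ∀ (g : List ℕ → Carrier) m K →
                ∑ g (boxes a b k (suc m) K) ≈ ∑ (λ x → ∑ (g ∘ (x ∷_)) (boxes a b k m K)) (upTo (suc K))
  ∑-boxes-suc g m K = ≈-trans
    (∑-concatMap g (λ x → map (x ∷_) (boxes a b k m K)) (upTo (suc K)))
    (∑-cong (λ x → reflexive (∑-map g (x ∷_) (boxes a b k m K))) (upTo (suc K)))

  ∑-boxes-truncate : ∀ m {N K} → N ≤ K → (g : List ℕ → Carrier) →
                     (∀ ys → ¬ All (_≤ N) ys → g ys ≈ 0#) →
                     ∑ g (boxes a b k m K) ≈ ∑ g (boxes a b k m N)
  ∑-boxes-truncate zero    _   g _      = ≈-refl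
  ∑-boxes-truncate (suc m) {N} {K} N≤K g vanish = begin
    ∑ g (boxes a b k (suc m) K)                                   ≈⟨ ∑-boxes-suc g m K ⟩
    ∑ (λ x → ∑ (g ∘ (x ∷_)) (boxes a b k m K)) (upTo (suc K))     ≈⟨ ∑-cong truncate-tails (upTo (suc K)) ⟩
    ∑ (λ x → ∑ (g ∘ (x ∷_)) (boxes a b k m N)) (upTo (suc K))     ≈⟨ truncate-heads ⟩
    ∑ (λ x → ∑ (g ∘ (x ∷_)) (boxes a b k m N)) (upTo (suc N))     ≈⟨ ∑-boxes-suc g m N ⟨
    ∑ g (boxes a b k (suc m) N)                                   ∎
    where
    truncate-tails : ∀ x → ∑ (g ∘ (x ∷_)) (boxes a b k m K) ≈ ∑ (g ∘ (x ∷_)) (boxes a b k m N)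
    truncate-tails x = ∑-boxes-truncate m N≤K (g ∘ (x ∷_)) (λ ys ¬≤N → vanish (x ∷ ys) (¬≤N ∘ All.tail))
    truncate-heads : ∑ (λ x → ∑ (g ∘ (x ∷_)) (boxes a b k m N)) (upTo (suc K))
                   ≈ ∑ (λ x → ∑ (g ∘ (x ∷_)) (boxes a b k m N)) (upTo (suc N))
    truncate-heads = ∑-applyUpTo-truncate _ id (s≤s N≤K)
      (λ x N<x → ∑-zero (λ ys → vanish (x ∷ ys) (ℕₚ.<⇒≱ N<x ∘ All.head)) (boxes a b k m N))

  ∑-boxes-head : ∀ m {N K} → N ≤ K → (g : List ℕ → Carrier) →
                 (∀ x ys → x ≢ N → g (x ∷ ys) ≈ 0#) →
                 ∑ g (boxes a b k (suc m) K) ≈ ∑ (g ∘ (N ∷_)) (boxes a b k m K)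
  ∑-boxes-head m {N} {K} N≤K g vanish = ≈-trans (∑-boxes-suc g m K)
    (∑-applyUpTo-single _ id N (s≤s N≤K)
      (λ x x≢N → ∑-zero (λ ys → vanish x ys x≢N) (boxes a b k m K)))

NonIncr⇒All≤head : ∀ x xs → NonIncr (x ∷ xs) → All (_≤ x) (x ∷ xs)
NonIncr⇒All≤head x []       _          = ℕₚ.≤-refl ∷ []
NonIncr⇒All≤head x (y ∷ ys) (y≤x , ni) =
  ℕₚ.≤-refl ∷ All.map (λ z≤y → ℕₚ.≤-trans z≤y y≤x) (NonIncr⇒All≤head y ys ni)

module _ (a b k : ℕ) .{{_ : NonZero k}} where

  maxPart-% : ∀ m h c → maxPart a b k m h c % k ≡ c % k
  maxPart-% m h c = %-remove-+ˡ c (∣m∣n⇒∣m+n (m∣m*n h) (m∣m*n (m ∸ 1)))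

  maxPart-suc-m : ∀ m h c → maxPart a b k (suc m) h c + k ≡ maxPart a b k (suc (suc m)) h c
  maxPart-suc-m m h c = identity k h m c
    where
    identity : ∀ r h m c → r * h + r * m + c + r ≡ r * h + r * suc m + c
    identity = solve-∀

  maxPart-suc-m-suc-h : ∀ m h c c′ →
    maxPart a b k (suc m) h c′ + 2 * k + c ≡ maxPart a b k (suc (suc m)) (suc h) c + c′
  maxPart-suc-m-suc-h m h c c′ = identity k h m c c′
    where
    identity : ∀ r h m c c′ → r * h + r * m + c′ + 2 * r + c ≡ r * suc h + r * suc m + c + c′
    identity = solve-∀

  BDmhc-bounded : ∀ m h c ys → BDmhc a b k m h c ys → All (_≤ maxPart a b k m h c) ys
  BDmhc-bounded m h c []       _                         = []
  BDmhc-bounded m h c (y ∷ ys) (((_ , ni) , _) , refl) = NonIncr⇒All≤head y ys ni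

  BD-∷⁺ : ∀ {m x y ys} → CongMod a b k x a ⊎ CongMod a b k x b → GapCond a b k x y →
          BD a b k m (y ∷ ys) → BD a b k (suc m) (x ∷ y ∷ ys)
  BD-∷⁺ {x = x} {y} x-res gap ((pos , ni) , len , res , lst , gaps) =
    ((0<x ∷ pos , y≤x , ni) , cong suc len , x-res ∷ res , lst , gap , gaps)
    where
    y+k≤x : y + k ≤ x
    y+k≤x = proj₁ gap
    y≤x : y ≤ x
    y≤x = ℕₚ.m+n≤o⇒m≤o y y+k≤x
    0<x : 0 < x
    0<x = ℕₚ.≤-trans (>-nonZero⁻¹ k) (ℕₚ.≤-trans (ℕₚ.m≤n+m k y) y+k≤x)

  BD-∷⁻ : ∀ {m x y ys} → BD a b k (suc m) (x ∷ y ∷ ys) → GapCond a b k x y × BD a b k m (y ∷ ys)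
  BD-∷⁻ ((pos , ni) , len , res , lst , gap , gaps) =
    gap , ((All.tail pos , proj₂ ni) , ℕₚ.suc-injective len , All.tail res , lst , gaps)

  module _ (1≤a : 1 ≤ a) (a<b : a < b) (b≤k : b ≤ k) where

    b<a+k : b < a + k
    b<a+k = ℕₚ.≤-<-trans b≤k (ℕₚ.m<n+m k 1≤a)

    a≢b[mod-k] : a % k ≢ b % k
    a≢b[mod-k] a≡b = ℕₚ.<⇒≢ a<b (%-window-unique k a≡b (ℕₚ.<-≤-trans a<b (ℕₚ.m≤m+n b k)) b<a+k)

    GapCond-a-a⇔ : ∀ {x y} → x % k ≡ a % k → y % k ≡ a % k → GapCond a b k x y ⇔ (y + k ≡ x)
    GapCond-a-a⇔ {x} {y} x≡a y≡a = mk⇔ to from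
      where
      regroup : ∀ y k → y + 2 * k ≡ y + k + k
      regroup = solve-∀

      to : GapCond a b k x y → y + k ≡ x
      to (y+k≤x , _ , _ , y≡a⇒x<y+2k) = %-window-unique k
        (trans ([m+n]%n≡m%n y k) (trans y≡a (sym x≡a)))
        (ℕₚ.≤-<-trans y+k≤x (ℕₚ.m<m+n x (>-nonZero⁻¹ k)))
        (subst (x <_) (regroup y k) (y≡a⇒x<y+2k y≡a))

      from : y + k ≡ x → GapCond a b k x y
      from y+k≡x = ℕₚ.≤-reflexive y+k≡x , (λ x≡b → contradiction (trans (sym x≡a) x≡b) a≢b[mod-k])
                 , ℕₚ.<⇒≤ x<y+2k , (λ _ → x<y+2k)
        where
        x<y+2k : x < y + 2 * k
        x<y+2k = subst₂ _<_ y+k≡x (sym (regroup y k)) (ℕₚ.m<m+n (y + k) (>-nonZero⁻¹ k))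

    -- The equation says y = x - 2k + (b - a), avoiding truncated subtraction.
    GapCond-a-b⇔ : ∀ {x y} → x % k ≡ a % k → y % k ≡ b % k →
                   GapCond a b k x y ⇔ (y + 2 * k + a ≡ x + b)
    GapCond-a-b⇔ {x} {y} x≡a y≡b = mk⇔ to from
      where
      regroup-a : ∀ y k a → y + 2 * k + a ≡ y + a + 2 * k
      regroup-a = solve-∀
      regroup-k : ∀ y k a → y + 2 * k + a ≡ y + k + (a + k)
      regroup-k = solve-∀

      to : GapCond a b k x y → y + 2 * k + a ≡ x + b
      to (y+k≤x , _ , x≤y+2k , _) = %-window-unique k residues lower upper
        where
        residues : (y + 2 * k + a) % k ≡ (x + b) % k
        residues = begin
          (y + 2 * k + a) % k ≡⟨ cong (_% k) (regroup-a y k a) ⟩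
          (y + a + 2 * k) % k ≡⟨ [m+kn]%n≡m%n (y + a) 2 k ⟩
          (y + a) % k         ≡⟨ +-%-cong k y≡b refl ⟩
          (b + a) % k         ≡⟨ cong (_% k) (ℕₚ.+-comm b a) ⟩
          (a + b) % k         ≡⟨ +-%-cong k x≡a refl ⟨
          (x + b) % k         ∎
          where open ≡-Reasoning
        lower : y + 2 * k + a < x + b + k
        lower = begin-strict
          y + 2 * k + a   ≡⟨ regroup-k y k a ⟩
          y + k + (a + k) <⟨ ℕₚ.+-mono-≤-< y+k≤x (ℕₚ.+-monoˡ-< k a<b) ⟩
          x + (b + k)     ≡⟨ ℕₚ.+-assoc x b k ⟨
          x + b + k       ∎
          where open ℕₚ.≤-Reasoning
        upper : x + b < y + 2 * k + a + k
        upper = begin-strict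
          x + b               <⟨ ℕₚ.+-mono-≤-< x≤y+2k b<a+k ⟩
          y + 2 * k + (a + k) ≡⟨ ℕₚ.+-assoc (y + 2 * k) a k ⟨
          y + 2 * k + a + k   ∎
          where open ℕₚ.≤-Reasoning

      from : y + 2 * k + a ≡ x + b → GapCond a b k x y
      from e = ℕₚ.<⇒≤ y+k<x , (λ _ → y+k<x) , ℕₚ.<⇒≤ x<y+2k , (λ _ → x<y+2k)
        where
        open ℕₚ.≤-Reasoning
        y+k<x : y + k < x
        y+k<x = ℕₚ.+-cancelʳ-< (a + k) (y + k) x (begin-strict
          y + k + (a + k) ≡⟨ regroup-k y k a ⟨
          y + 2 * k + a   ≡⟨ e ⟩
          x + b           <⟨ ℕₚ.+-monoʳ-< x b<a+k ⟩
          x + (a + k)     ∎)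
        x<y+2k : x < y + 2 * k
        x<y+2k = ℕₚ.+-cancelʳ-< b x (y + 2 * k) (begin-strict
          x + b         ≡⟨ e ⟨
          y + 2 * k + a <⟨ ℕₚ.+-monoʳ-< (y + 2 * k) a<b ⟩
          y + 2 * k + b ∎)

    module _ (m h : ℕ) where

      private
        N Na Nb : ℕ
        N  = maxPart a b k (suc (suc m)) (suc h) a
        Na = maxPart a b k (suc m) (suc h) a
        Nb = maxPart a b k (suc m) h b

        N≡a : N % k ≡ a % k
        N≡a = maxPart-% (suc (suc m)) (suc h) a

      GapCond-maxPart-a : GapCond a b k N Na
      GapCond-maxPart-a = Equivalence.from (GapCond-a-a⇔ N≡a (maxPart-% (suc m) (suc h) a))
        (maxPart-suc-m m (suc h) a)

      GapCond-maxPart-b : GapCond a b k N Nb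
      GapCond-maxPart-b = Equivalence.from (GapCond-a-b⇔ N≡a (maxPart-% (suc m) h b))
        (maxPart-suc-m-suc-h m h a b)

      BDmhc-∷⁺ : ∀ ys → BDmhc a b k (suc m) (suc h) a ys ⊎ BDmhc a b k (suc m) h b ys →
                 BDmhc a b k (suc (suc m)) (suc h) a (N ∷ ys)
      BDmhc-∷⁺ []       (inj₁ (_ , ()))
      BDmhc-∷⁺ []       (inj₂ (_ , ()))
      BDmhc-∷⁺ (_ ∷ _) (inj₁ (bd , refl)) = BD-∷⁺ (inj₁ N≡a) GapCond-maxPart-a bd , refl
      BDmhc-∷⁺ (_ ∷ _) (inj₂ (bd , refl)) = BD-∷⁺ (inj₁ N≡a) GapCond-maxPart-b bd , refl

      BDmhc-∷⁻ : ∀ ys → BDmhc a b k (suc (suc m)) (suc h) a (N ∷ ys) →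
                 BDmhc a b k (suc m) (suc h) a ys ⊎ BDmhc a b k (suc m) h b ys
      BDmhc-∷⁻ []       ((_ , () , _) , _)
      BDmhc-∷⁻ (y ∷ ys) (bd , _) with BD-∷⁻ bd
      ... | gap , bd′@(_ , _ , inj₁ y≡a ∷ _ , _) =
        inj₁ (bd′ , cong just (ℕₚ.+-cancelʳ-≡ k y Na (begin
          y + k  ≡⟨ Equivalence.to (GapCond-a-a⇔ N≡a y≡a) gap ⟩
          N      ≡⟨ maxPart-suc-m m (suc h) a ⟨
          Na + k ∎)))
        where open ≡-Reasoning
      ... | gap , bd′@(_ , _ , inj₂ y≡b ∷ _ , _) =
        inj₂ (bd′ , cong just (ℕₚ.+-cancelʳ-≡ (2 * k) y Nb (ℕₚ.+-cancelʳ-≡ a _ _ (begin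
          y + 2 * k + a  ≡⟨ Equivalence.to (GapCond-a-b⇔ N≡a y≡b) gap ⟩
          N + b          ≡⟨ maxPart-suc-m-suc-h m h a b ⟨
          Nb + 2 * k + a ∎))))
        where open ≡-Reasoning

    BDmhc-a-b-disjoint : ∀ {m h h′} ys → ¬ (BDmhc a b k m h a ys × BDmhc a b k m h′ b ys)
    BDmhc-a-b-disjoint {m} {h} {h′} (y ∷ _) ((_ , y≡Na) , (_ , y≡Nb)) = a≢b[mod-k] (begin
      a % k                       ≡⟨ maxPart-% m h a ⟨
      maxPart a b k m h a % k     ≡⟨ cong (_% k) (trans (sym (just-injective y≡Na)) (just-injective y≡Nb)) ⟩
      maxPart a b k m h′ b % k    ≡⟨ maxPart-% m h′ b ⟩
      b % k                       ∎)
      where open ≡-Reasoning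

    module _ {ℓ₁ ℓ₂ : Level} (R : CommutativeSemiring ℓ₁ ℓ₂) (u v q : CommutativeSemiring.Carrier R) where
      open CommutativeSemiring R
        renaming (_+_ to _⊕_; _*_ to _⊛_; refl to ≈-refl; sym to ≈-sym; trans to ≈-trans)
      open RawSemiringDefinitions rawSemiring using (_^_)
      open SemiringExp semiring using (^-homo-*)
      open CommutativeSemigroupProperties *-commutativeSemigroup using (interchange)
      open ListSum R
      open BoxSum a b k R
      open import Relation.Binary.Reasoning.Setoid setoid

      weight : List ℕ → Carrier
      weight λs = (u ^ ℓ a b k a λs ⊛ v ^ ℓ a b k b λs) ⊛ q ^ size a b k λs

      weight-∷ : ∀ {x} ys → x % k ≡ a % k → weight (x ∷ ys) ≈ (u ⊛ q ^ x) ⊛ weight ys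
      weight-∷ {x} ys x≡a = begin
        (u ^ ℓ a b k a (x ∷ ys) ⊛ v ^ ℓ a b k b (x ∷ ys)) ⊛ q ^ (x + size a b k ys)
          ≈⟨ *-cong (*-cong (reflexive (cong (u ^_) ℓa-∷)) (reflexive (cong (v ^_) ℓb-∷)))
                    (^-homo-* q x (size a b k ys)) ⟩
        (u ⊛ u ^ ℓ a b k a ys ⊛ v ^ ℓ a b k b ys) ⊛ (q ^ x ⊛ q ^ size a b k ys)
          ≈⟨ *-congʳ (*-assoc u _ _) ⟩
        (u ⊛ (u ^ ℓ a b k a ys ⊛ v ^ ℓ a b k b ys)) ⊛ (q ^ x ⊛ q ^ size a b k ys)
          ≈⟨ interchange u _ (q ^ x) _ ⟩
        (u ⊛ q ^ x) ⊛ weight ys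
          ∎
        where
        ℓa-∷ : ℓ a b k a (x ∷ ys) ≡ suc (ℓ a b k a ys)
        ℓa-∷ = cong length (filter-accept (λ z → congMod? a b k z a) x≡a)
        ℓb-∷ : ℓ a b k b (x ∷ ys) ≡ ℓ a b k b ys
        ℓb-∷ = cong length (filter-reject (λ z → congMod? a b k z b) (a≢b[mod-k] ∘ trans (sym x≡a)))

      GF-as-∑-boxes : ∀ m h c {K} → maxPart a b k m h c ≤ K →
                      GF a b k R u v q m h c ≈ ∑ (restrict (BDmhc? a b k m h c) weight) (boxes a b k m K)
      GF-as-∑-boxes m h c bound = ≈-trans
        (∑-filter P? weight (boxes a b k m (maxPart a b k m h c)))
        (≈-sym (∑-boxes-truncate m bound _ vanish))
        where
        P? : Decidable (BDmhc a b k m h c)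
        P? = BDmhc? a b k m h c
        vanish : ∀ ys → ¬ All (_≤ maxPart a b k m h c) ys → restrict P? weight ys ≈ 0#
        vanish ys ¬bounded = indicator-no (P? ys) (¬bounded ∘ BDmhc-bounded m h c ys)

      module _ (m h : ℕ) where

        private
          N : ℕ
          N = maxPart a b k (suc (suc m)) (suc h) a
          C : Carrier
          C = u ⊛ q ^ N
          box : List (List ℕ)
          box = boxes a b k (suc m) N
          P? : Decidable (BDmhc a b k (suc (suc m)) (suc h) a)
          P? = BDmhc? a b k (suc (suc m)) (suc h) a
          Pa? : Decidable (BDmhc a b k (suc m) (suc h) a)
          Pa? = BDmhc? a b k (suc m) (suc h) a
          Pb? : Decidable (BDmhc a b k (suc m) h b)
          Pb? = BDmhc? a b k (suc m) h b

        restrict-BDmhc-∷ : ∀ ys →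
          restrict P? weight (N ∷ ys) ≈ C ⊛ (restrict Pa? weight ys ⊕ restrict Pb? weight ys)
        restrict-BDmhc-∷ ys = begin
          indicator (P? (N ∷ ys)) (weight (N ∷ ys))
            ≈⟨ indicator-cong (P? (N ∷ ys)) (weight-∷ ys (maxPart-% (suc (suc m)) (suc h) a)) ⟩
          indicator (P? (N ∷ ys)) (C ⊛ weight ys)
            ≈⟨ indicator-*ˡ (P? (N ∷ ys)) C (weight ys) ⟩
          C ⊛ indicator (P? (N ∷ ys)) (weight ys)
            ≈⟨ *-congˡ (indicator-⊎ (P? (N ∷ ys)) (Pa? ys) (Pb? ys)
                 (mk⇔ (BDmhc-∷⁻ m h ys) (BDmhc-∷⁺ m h ys)) (BDmhc-a-b-disjoint ys)) ⟩
          C ⊛ (restrict Pa? weight ys ⊕ restrict Pb? weight ys)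
            ∎

        GF-recurrence :
          GF a b k R u v q (suc (suc m)) (suc h) a ≈
          C ⊛ (GF a b k R u v q (suc m) (suc h) a ⊕ GF a b k R u v q (suc m) h b)
        GF-recurrence = begin
          GF a b k R u v q (suc (suc m)) (suc h) a
            ≈⟨ GF-as-∑-boxes (suc (suc m)) (suc h) a ℕₚ.≤-refl ⟩
          ∑ (restrict P? weight) (boxes a b k (suc (suc m)) N)
            ≈⟨ ∑-boxes-head (suc m) ℕₚ.≤-refl _ off-head ⟩
          ∑ (λ ys → restrict P? weight (N ∷ ys)) box
            ≈⟨ ∑-cong restrict-BDmhc-∷ box ⟩
          ∑ (λ ys → C ⊛ (restrict Pa? weight ys ⊕ restrict Pb? weight ys)) box
            ≈⟨ ∑-*ˡ C _ box ⟩
          C ⊛ ∑ (λ ys → restrict Pa? weight ys ⊕ restrict Pb? weight ys) box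
            ≈⟨ *-congˡ (∑-+ _ _ box) ⟩
          C ⊛ (∑ (restrict Pa? weight) box ⊕ ∑ (restrict Pb? weight) box)
            ≈⟨ *-congˡ (+-cong (GF-as-∑-boxes (suc m) (suc h) a Na≤N) (GF-as-∑-boxes (suc m) h b Nb≤N)) ⟨
          C ⊛ (GF a b k R u v q (suc m) (suc h) a ⊕ GF a b k R u v q (suc m) h b)
            ∎
          where
          off-head : ∀ x ys → x ≢ N → restrict P? weight (x ∷ ys) ≈ 0#
          off-head x ys x≢N = indicator-no (P? (x ∷ ys)) (x≢N ∘ just-injective ∘ proj₂)
          Na≤N : maxPart a b k (suc m) (suc h) a ≤ N
          Na≤N = ℕₚ.m+n≤o⇒m≤o _ (proj₁ (GapCond-maxPart-a m h))
          Nb≤N : maxPart a b k (suc m) h b ≤ N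
          Nb≤N = ℕₚ.m+n≤o⇒m≤o _ (proj₁ (GapCond-maxPart-b m h))

mainTheorem15 : ∀ {c ℓ : Level} (a b k : ℕ) .{{_ : NonZero k}}
    → 1 ≤ a → a < b → b ≤ k
    → (m h : ℕ) → 2 ≤ m → 1 ≤ h → h ≤ m ∸ 1
    → (R : CommutativeSemiring c ℓ)
    → (u v q : CommutativeSemiring.Carrier R)
    → CommutativeSemiring._≈_ R
        (GF a b k R u v q (m + 1) h a)
        (CommutativeSemiring._*_ R
          (CommutativeSemiring._*_ R u
            (pow R q (k * h + k * m + a)))
          (CommutativeSemiring._+_ R
            (GF a b k R u v q m h a)
            (GF a b k R u v q m (h ∸ 1) b)))
mainTheorem15 a b k 1≤a a<b b≤k (suc m) (suc h) (s≤s _) _ _ R u v q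
  rewrite ℕₚ.+-comm m 1 = GF-recurrence a b k 1≤a a<b b≤k R u v q m h
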